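{- For all $\alpha,\beta,\gamma\in\Phi_{XY}$, all $\phi,\psi\in\Phi$ and every closed formula $\chi$, the following formulas are valid: (1) $[\alpha](\phi\land\psi)\leftrightarrow([\alpha]\phi\land[\alpha]\psi)$; (2) $[\alpha](\phi\lor\chi)\leftrightarrow([\alpha]\phi\lor[\alpha]\chi)$; (3) $[\alpha][\beta]\gamma\leftrightarrow[\alpha\land\beta]\gamma$; (4) $[\alpha]\langle\beta\rangle\gamma\leftrightarrow([\alpha]\bot\lor\langle\alpha\land\beta\rangle\gamma)$; (5) $[\alpha]\beta\leftrightarrow\Box(\alpha\rightarrow\beta)$.
   Context: Let $\mathsf{AP}$ be a countable set of atomic propositions. The language $\Phi_{XY}$ is given by $\alpha ::= p \mid \bot \mid \neg\alpha \mid (\alpha\land\alpha) \mid \mathtt{X}\alpha \mid \mathtt{Y}\alpha$ with $p\in\mathsf{AP}$. The language $\Phi$ is given by $\phi ::= p \mid \bot \mid \neg\phi \mid (\phi\land\phi) \mid \mathtt{X}\phi \mid \mathtt{Y}\phi \mid [\alpha]\phi$ with $\alpha\in\Phi_{XY}$. Abbreviations: $\top,\lor,\rightarrow,\leftrightarrow$ as usual; $\langle\alpha\rangle\phi:=\neg[\alpha]\neg\phi$; $\Box\phi:=[\top]\phi$. Closed formulas are given by $\chi ::= [\alpha]\phi \mid \neg\chi \mid (\chi\land\chi)$ with $\alpha\in\Phi_{XY}$, $\phi\in\Phi$. A model is $M=(W,<,V)$ where $W$ is a nonempty set, $<$ is a serial binary relation on $W$ such that there is $r\in W$ (the root) with: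 for every $w\in W$ there is a unique finite sequence $x_0,\dots,x_n$ with $x_0=r$, $x_n=w$, $x_0<x_1<\dots<x_n$; and $V:\mathsf{AP}\to\mathcal P(W)$. A timeline is an infinite sequence $\pi=x_0,x_1,\dots$ with $x_0=r$ and $x_k<x_{k+1}$ for all $k$; $\pi[i]:=x_i$; $TL(M)$ is the set of timelines; instants are natural numbers. A context for $M$ is a finite (possibly empty) set $C$ of subsets of $TL(M)$; $AT(C):=TL(M)\cap\bigcap_{R\in C}R$. A contextualized pointed model is $(M,C,\pi,i)$ with $C$ a context for $M$, $\pi\in AT(C)$, $i\in\mathbb N$. Satisfaction $M,C,\pi,i\Vdash\phi$ (for $\pi\in TL(M)$): $p$ iff $\pi[i]\in V(p)$; $\bot$ never; $\neg,\land$ classically; $\mathtt{X}\phi$ iff $M,C,\pi,i+1\Vdash\phi$; $\mathtt{Y}\phi$ iff $i=0$ or $M,C,\pi,i-1\Vdash\phi$; $[\alpha]\phi$ iff $M,C^{\alpha}_i,\pi',i\Vdash\phi$ for every $\pi'\in AT(C^{\alpha}_i)$, where $C^{\alpha}_i:=C\cup\{\|\alpha\|_i\}$ and $\|\alpha\|_i:=\{\pi'\in TL(M): M,C,\pi',i\Vdash\alpha\}$. A formula is valid if it is true at every contextualized pointed model. -}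

module Defs where

open import Data.Nat using (ℕ; zero; suc)
open import Data.Bool using (Bool; T)
open import Data.List using (List; []; _∷_)
open import Data.Product using (Σ; ∃; _×_)
open import Data.Unit using (⊤)
open import Data.Empty using (⊥)
open import Relation.Nullary using (¬_)
open import Relation.Binary.PropositionalEquality using (_≡_)

AP : Set
AP = ℕ

data ΦXY : Set where
  atom : AP → ΦXY
  ⊥′   : ΦXY
  ¬′_  : ΦXY → ΦXY
  _∧′_ : ΦXY → ΦXY → ΦXY
  X′_  : ΦXY → ΦXY
  Y′_  : ΦXY → ΦXY

data Φ : Set where
  atom : AP → Φ
  ⊥′   : Φ
  ¬′_  : Φ → Φ
  _∧′_ : Φ → Φ → Φ
  X′_  : Φ → Φ
  Y′_  : Φ → Φ
  [_]_ : ΦXY → Φ → Φ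

ι : ΦXY → Φ
ι (atom p) = atom p
ι ⊥′ = ⊥′
ι (¬′ a) = ¬′ ι a
ι (a ∧′ b) = ι a ∧′ ι b
ι (X′ a) = X′ ι a
ι (Y′ a) = Y′ ι a

⊤X : ΦXY
⊤X = ¬′ ⊥′

⊤Φ : Φ
⊤Φ = ¬′ ⊥′

_∨′_ : Φ → Φ → Φ
a ∨′ b = ¬′ ((¬′ a) ∧′ (¬′ b))

_⇒′_ : Φ → Φ → Φ
a ⇒′ b = ¬′ (a ∧′ (¬′ b))

_⇔′_ : Φ → Φ → Φ
a ⇔′ b = (a ⇒′ b) ∧′ (b ⇒′ a)

⟨_⟩_ : ΦXY → Φ → Φ
⟨ a ⟩ f = ¬′ ([ a ] (¬′ f))

□ : Φ → Φ
□ f = [ ⊤X ] f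

data Closed : Φ → Set where
  box : ∀ a f → Closed ([ a ] f)
  neg : ∀ {c} → Closed c → Closed (¬′ c)
  conj : ∀ {c d} → Closed c → Closed d → Closed (c ∧′ d)

data Chain {W : Set} (_<_ : W → W → Set) : W → W → List W → Set where
  here : ∀ {a} → Chain _<_ a a (a ∷ [])
  step : ∀ {a b c xs} → a < b → Chain _<_ b c xs → Chain _<_ a c (a ∷ xs)

record Model : Set₁ where
  field
    W      : Set
    _<_    : W → W → Set
    serial : ∀ w → ∃ λ v → w < v
    root   : W
    pathExists : ∀ w → ∃ λ xs → Chain _<_ root w xs
    pathUnique : ∀ w xs ys → Chain _<_ root w xs → Chain _<_ root w ys → xs ≡ ys
    -- valuation V : AP → 𝒫(W), subsets given by characteristic functions
    V      : AP → W → Bool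

module _ (M : Model) where
  open Model M

  record Timeline : Set where
    field
      at    : ℕ → W
      start : at 0 ≡ root
      next  : ∀ k → at k < at (suc k)
  open Timeline public

  -- A context: a finite set of subsets of TL(M)
  Context : Set₁
  Context = List (Timeline → Set)

  AT : Context → Timeline → Set
  AT [] π = ⊤
  AT (R ∷ C) π = R π × AT C π

  satXY : Context → Timeline → ℕ → ΦXY → Set
  satXY C π i (atom p) = T (V p (at π i))
  satXY C π i ⊥′ = ⊥
  satXY C π i (¬′ a) = ¬ satXY C π i a
  satXY C π i (a ∧′ b) = satXY C π i a × satXY C π i b
  satXY C π i (X′ a) = satXY C π (suc i) a
  satXY C π zero (Y′ a) = ⊤
  satXY C π (suc i) (Y′ a) = satXY C π i a

  ext : Context → ℕ → ΦXY → (Timeline → Set)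
  ext C i a π′ = satXY C π′ i a

  sat : Context → Timeline → ℕ → Φ → Set
  sat C π i (atom p) = T (V p (at π i))
  sat C π i ⊥′ = ⊥
  sat C π i (¬′ f) = ¬ sat C π i f
  sat C π i (f ∧′ g) = sat C π i f × sat C π i g
  sat C π i (X′ f) = sat C π (suc i) f
  sat C π zero (Y′ f) = ⊤
  sat C π (suc i) (Y′ f) = sat C π i f
  sat C π i ([ a ] f) =
    ∀ (π′ : Timeline) → AT (ext C i a ∷ C) π′ → sat (ext C i a ∷ C) π′ i f

Valid : Φ → Set₁
Valid f = ∀ (M : Model) (C : Context M) (π : Timeline M) → AT M C π → (i : ℕ) → sat M C π i f

{-# OPTIONS --safe #-}
module Submission where

-- Satisfaction of a formula of Φ_XY ignores the context, and a closed formula is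
-- a statement about the context alone, so its truth does not depend on the
-- timeline. Hence the timelines reached by [α][β] are exactly those reached by
-- [α ∧ β], and a closed formula under [α] is either vacuously true (no timeline
-- satisfies α) or true at the updated context. Satisfaction is ¬¬-stable, which
-- supplies the classical steps in (2) and (5).

open import Defs
open import Data.List using ([]; _∷_)
open import Data.Nat using (zero; suc)
open import Data.Product using (_×_; _,_; proj₁; proj₂)
open import Data.Product.Function.NonDependent.Propositional using (_×-⇔_)
open import Data.Unit using (tt)
open import Function using (id; _∘_)
open import Function.Bundles using (_⇔_; mk⇔; Equivalence)
open import Function.Construct.Composition using (_⇔-∘_)
open import Function.Construct.Symmetry using (⇔-sym)
open import Function.Related.TypeIsomorphisms using (¬-cong-⇔)
open import Relation.Nullary.Decidable using (decidable-stable; T?)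
open import Relation.Nullary.Negation using (Stable)

open Equivalence using (to; from)

infix 4 _≈_

-- A record rather than a function, so that A and B can be inferred from A ≈ B.
record _≈_ (A B : Φ) : Set₁ where
  field sat-⇔ : ∀ M C π i → sat M C π i A ⇔ sat M C π i B
open _≈_

valid-⇔′ : ∀ {A B} → A ≈ B → Valid (A ⇔′ B)
valid-⇔′ A≈B M C π _ i =
    (λ (a , ¬b) → ¬b (to A⇔B a)) , (λ (b , ¬a) → ¬a (from A⇔B b))
  where A⇔B = sat-⇔ A≈B M C π i

module _ (M : Model) where

  sat-stable : ∀ f {C π i} → Stable (sat M C π i f)
  sat-stable (atom p)               = decidable-stable (T? _)
  sat-stable ⊥′ ¬¬⊥                 = ¬¬⊥ id
  sat-stable (¬′ f) ¬¬¬f            = ¬¬¬f ∘ (λ f ¬f → ¬f f)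
  sat-stable (f ∧′ g) ¬¬fg          =
    sat-stable f (λ ¬f → ¬¬fg (¬f ∘ proj₁)) , sat-stable g (λ ¬g → ¬¬fg (¬g ∘ proj₂))
  sat-stable (X′ f)                 = sat-stable f
  sat-stable (Y′ f) {i = zero} _    = tt
  sat-stable (Y′ f) {i = suc i}     = sat-stable f
  sat-stable ([ α ] f) ¬¬h π′ at    = sat-stable f (λ ¬f → ¬¬h (λ h → ¬f (h π′ at)))

  -- satXY never inspects its context, so that argument cannot be inferred and D is explicit.
  sat-ι⇔satXY : ∀ g D {C π i} → sat M C π i (ι g) ⇔ satXY M D π i g
  sat-ι⇔satXY (atom p) D             = mk⇔ id id
  sat-ι⇔satXY ⊥′       D             = mk⇔ id id
  sat-ι⇔satXY (¬′ g)   D             = ¬-cong-⇔ (sat-ι⇔satXY g D)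
  sat-ι⇔satXY (g ∧′ h) D             = sat-ι⇔satXY g D ×-⇔ sat-ι⇔satXY h D
  sat-ι⇔satXY (X′ g)   D             = sat-ι⇔satXY g D
  sat-ι⇔satXY (Y′ g)   D {i = zero}  = mk⇔ id id
  sat-ι⇔satXY (Y′ g)   D {i = suc i} = sat-ι⇔satXY g D

  sat-ι-context : ∀ g {C D π i} → sat M C π i (ι g) ⇔ sat M D π i (ι g)
  sat-ι-context g = ⇔-sym (sat-ι⇔satXY g []) ⇔-∘ sat-ι⇔satXY g []

  satXY-context : ∀ g C D {π i} → satXY M C π i g → satXY M D π i g
  satXY-context g C D = to (sat-ι⇔satXY g D {C = []}) ∘ from (sat-ι⇔satXY g C)

  sat-closed-timeline : ∀ {χ} → Closed χ → ∀ {C π π′ i} → sat M C π i χ → sat M C π′ i χ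
  sat-closed-timeline (box α f)  h         = h
  sat-closed-timeline (neg c)    ¬χ χ      = ¬χ (sat-closed-timeline c χ)
  sat-closed-timeline (conj c d) (χ₁ , χ₂) = sat-closed-timeline c χ₁ , sat-closed-timeline d χ₂

  AT-nested : ∀ α β C i {π} →
    let C₁ = ext M C i α ∷ C in
    AT M (ext M C₁ i β ∷ C₁) π ⇔ AT M (ext M C i (α ∧′ β) ∷ C) π
  AT-nested α β C i = mk⇔ (λ (b , a , c) → (a , satXY-context β C₁ C b) , c)
                          (λ ((a , b) , c) → satXY-context β C C₁ b , a , c)
    where C₁ = ext M C i α ∷ C

  box-ι-nested : ∀ α β γ C i π′ π →
    sat M (ext M C i α ∷ C) π′ i ([ β ] ι γ) ⇔ sat M C π i ([ α ∧′ β ] ι γ)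
  box-ι-nested α β γ C i _ _ = mk⇔
    (λ h π″ at → to (sat-ι-context γ) (h π″ (from (AT-nested α β C i) at)))
    (λ h π″ at → to (sat-ι-context γ) (h π″ (to (AT-nested α β C i) at)))

box-distrib-∧ : ∀ α φ ψ →
  ([ α ] (φ ∧′ ψ)) ≈ (([ α ] φ) ∧′ ([ α ] ψ))
box-distrib-∧ α φ ψ .sat-⇔ M _ _ _ = mk⇔
  (λ h → (λ π′ at → proj₁ (h π′ at)) , (λ π′ at → proj₂ (h π′ at)))
  (λ (h₁ , h₂) π′ at → h₁ π′ at , h₂ π′ at)

box-distrib-∨-closed : ∀ α φ {χ} → Closed χ →
  ([ α ] (φ ∨′ χ)) ≈ (([ α ] φ) ∨′ ([ α ] χ))
box-distrib-∨-closed α φ {χ} closed .sat-⇔ M _ _ _ = mk⇔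
  (λ h (¬hφ , ¬hχ) → ¬hχ λ π′ at → sat-stable M χ λ ¬χ →
     ¬hφ λ π″ at″ → sat-stable M φ λ ¬φ →
       h π″ at″ (¬φ , ¬χ ∘ sat-closed-timeline M closed))
  (λ h∨ π′ at (¬φ , ¬χ) → h∨ ((λ h → ¬φ (h π′ at)) , (λ h → ¬χ (h π′ at))))

box-box : ∀ α β γ →
  ([ α ] ([ β ] ι γ)) ≈ ([ α ∧′ β ] ι γ)
box-box α β γ .sat-⇔ M C π i = mk⇔
  (λ h π″ at@((a , _) , c) → to (box-ι-nested M α β γ C i π″ π) (h π″ (a , c)) π″ at)
  (λ h π′ _ → from (box-ι-nested M α β γ C i π′ π) h)

-- ⟨ β ⟩ ι γ unfolds to ¬′ [ β ] ι (¬′ γ), so box-ι-nested applies with ¬′ γ.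
box-diamond : ∀ α β γ →
  ([ α ] (⟨ β ⟩ ι γ)) ≈ (([ α ] ⊥′) ∨′ (⟨ α ∧′ β ⟩ ι γ))
box-diamond α β γ .sat-⇔ M C π i = mk⇔
  (λ h (¬h⊥ , ¬◇) → ¬◇ λ h¬γ →
     ¬h⊥ λ π′ at → h π′ at (from (box-ι-nested M α β (¬′ γ) C i π′ π) h¬γ))
  (λ h∨ π′ at h¬γ →
     h∨ ((λ h⊥ → h⊥ π′ at) , (λ ¬◇ → ¬◇ (to (box-ι-nested M α β (¬′ γ) C i π′ π) h¬γ))))

box⇔□⇒ : ∀ α β →
  ([ α ] ι β) ≈ (□ (ι α ⇒′ ι β))
box⇔□⇒ α β .sat-⇔ M C _ _ = mk⇔
  (λ h π′ (_ , c) (a , ¬b) →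
     ¬b (to (sat-ι-context M β) (h π′ (to (sat-ι⇔satXY M α C) a , c))))
  (λ □⇒ π′ (a , c) → sat-stable M (ι β) λ ¬b →
     □⇒ π′ (id , c) (from (sat-ι⇔satXY M α C) a , ¬b ∘ to (sat-ι-context M β)))

lemma2 : (α β γ : ΦXY) (φ ψ χ : Φ) → Closed χ →
    Valid (([ α ] (φ ∧′ ψ)) ⇔′ (([ α ] φ) ∧′ ([ α ] ψ)))
    × Valid (([ α ] (φ ∨′ χ)) ⇔′ (([ α ] φ) ∨′ ([ α ] χ)))
    × Valid (([ α ] ([ β ] ι γ)) ⇔′ ([ α ∧′ β ] ι γ))
    × Valid (([ α ] (⟨ β ⟩ ι γ)) ⇔′ (([ α ] ⊥′) ∨′ (⟨ α ∧′ β ⟩ ι γ)))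
    × Valid (([ α ] ι β) ⇔′ □ (ι α ⇒′ ι β))
lemma2 α β γ φ ψ χ closed =
    valid-⇔′ (box-distrib-∧ α φ ψ)
  , valid-⇔′ (box-distrib-∨-closed α φ closed)
  , valid-⇔′ (box-box α β γ)
  , valid-⇔′ (box-diamond α β γ)
  , valid-⇔′ (box⇔□⇒ α β)
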